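{- Let $n \ge 1$ and let $T$ be a plane tree with $n$ edges, written as its set of index pairs $T=\{(i,j)\}$ (a noncrossing perfect matching of $[1,2n]$). Define $$\phi(T) = \{(k-1,2n) \mid (1,k) \in T\} \cup \{(i-1,j-1) \mid (i,j) \in T,\ 1 < i < j \le 2n\}.$$ Then $T$ and $\phi(T)$ are complements, i.e. the multigraph on vertex set $[1,2n]$ whose edges are the pairs of $T$ together with the pairs of $\phi(T)$ is connected (it forms a single closed loop through all $2n$ indices).
   Context: A plane tree is a rooted tree whose subtrees (children of each vertex) are linearly ordered. For a plane tree with $n$ edges, walk around its boundary counterclockwise starting from the root and label the $2n$ successive edge-sides by $1,2,\dots,2n$; each edge then receives two labels $i<j$ (its left and right side) and is written $(i,j)$. This identifies a plane tree with $n$ edges with a noncrossing perfect matching of $[1,2n]=\{1,\dots,2n\}$ (a partition of $[1,2n]$ into $n$ pairs with no two pairs $(a,c),(b,d)$ satisfying $a<b<c<d$). The map $\phi$ is a bijection on such trees corresponding to rerooting the tree one edge-side counterclockwise. Since the union of two perfect matchings of $[1,2n]$ is a disjoint union of cycles (possibly double edges), "connected" means the two matchings together form a single closed loop (a meander). -}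

module Defs where

open import Data.Nat using (ℕ; _+_; _*_; _∸_; _≤_; _<_)
open import Data.Product using (Σ; _×_; ∃-syntax)
open import Data.Sum using (_⊎_)
open import Data.Empty using (⊥)
open import Relation.Binary.PropositionalEquality using (_≡_; _≢_)
open import Relation.Binary.Construct.Closure.ReflexiveTransitive using (Star)

-- A perfect matching of [1,2n] is given by its partner function m:
-- every k ∈ [1,2n] is paired with m k ∈ [1,2n], m k ≠ k, m (m k) = k.
-- (Values of m outside [1,2n] are irrelevant.)
record IsPerfectMatching (n : ℕ) (m : ℕ → ℕ) : Set where
  field
    inRange : ∀ k → 1 ≤ k → k ≤ 2 * n → 1 ≤ m k × m k ≤ 2 * n
    noFix   : ∀ k → 1 ≤ k → k ≤ 2 * n → m k ≢ k
    invol   : ∀ k → 1 ≤ k → k ≤ 2 * n → m (m k) ≡ k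

Pair : (n : ℕ) → (ℕ → ℕ) → ℕ → ℕ → Set
Pair n m i j = 1 ≤ i × i < j × j ≤ 2 * n × m i ≡ j

NonCrossing : (n : ℕ) → (ℕ → ℕ) → Set
NonCrossing n m = ∀ a b c d → a < b → b < c → c < d →
  Pair n m a c → Pair n m b d → ⊥

record IsPlaneTree (n : ℕ) (m : ℕ → ℕ) : Set where
  field
    matching    : IsPerfectMatching n m
    noncrossing : NonCrossing n m

PhiPair : (n : ℕ) → (ℕ → ℕ) → ℕ → ℕ → Set
PhiPair n m a b =
    (∃[ k ] (Pair n m 1 k × a ≡ k ∸ 1 × b ≡ 2 * n))
  ⊎ (∃[ i ] ∃[ j ] (Pair n m i j × 1 < i × a ≡ i ∸ 1 × b ≡ j ∸ 1))

UnionEdge : (n : ℕ) → (ℕ → ℕ) → ℕ → ℕ → Set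
UnionEdge n m a b =
  (Pair n m a b ⊎ Pair n m b a) ⊎ (PhiPair n m a b ⊎ PhiPair n m b a)

Complements : (n : ℕ) → (ℕ → ℕ) → Set
Complements n m = ∀ x y → 1 ≤ x → x ≤ 2 * n → 1 ≤ y → y ≤ 2 * n →
  Star (UnionEdge n m) x y

-- Call (i, j) closed when m maps every index strictly between i and j into
-- [i, j).  Noncrossing makes the inside of every pair (i, m i) closed, and
-- (1, 2n+1) is closed trivially.  In a closed interval every x ≥ i is joined
-- to i, by induction on j and then on x: if m x < x, follow the T-edge to
-- m x; if x < m x, the smaller closed interval (x, m x) joins x to m x - 1,
-- and the φ-edge (x - 1, m x - 1) then leads on to x - 1.
module Submission where

open import Defs
open import Data.Nat using (ℕ; suc; _*_; _∸_; _≤_; _<_; s≤s)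
open import Data.Nat.Properties
  using ( <-cmp; ≤-refl; ≤-reflexive; ≤-trans; <-trans; <-≤-trans; <⇒≤; <⇒≢; ≤-pred
        ; m≤n⇒m<n∨m≡n; n≤1+n)
open import Data.Nat.Induction using (<-wellFounded)
open import Induction.WellFounded using (Acc; acc)
open import Data.Product using (_×_; _,_; proj₁; proj₂)
open import Data.Sum using (_⊎_; inj₁; inj₂)
open import Data.Empty using (⊥-elim)
open import Relation.Binary using (Symmetric; tri<; tri≈; tri>)
open import Relation.Binary.PropositionalEquality using (_≡_; refl; sym; cong; module ≡-Reasoning)
open import Relation.Binary.Construct.Closure.ReflexiveTransitive
  using (Star; ε; _◅_; _◅◅_; reverse)

∸1-between : ∀ {a b} → a < b → a ≤ b ∸ 1 × b ∸ 1 < b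
∸1-between (s≤s a≤b-1) = a≤b-1 , ≤-refl

Closed : (ℕ → ℕ) → ℕ → ℕ → Set
Closed m i j = ∀ x → i < x → x < j → i ≤ m x × m x < j

module _ (n : ℕ) (m : ℕ → ℕ) where

  infix 4 _⇝_
  _⇝_ : ℕ → ℕ → Set
  x ⇝ y = Star (UnionEdge n m) x y

  UnionEdge-sym : Symmetric (UnionEdge n m)
  UnionEdge-sym (inj₁ (inj₁ p)) = inj₁ (inj₂ p)
  UnionEdge-sym (inj₁ (inj₂ p)) = inj₁ (inj₁ p)
  UnionEdge-sym (inj₂ (inj₁ p)) = inj₂ (inj₂ p)
  UnionEdge-sym (inj₂ (inj₂ p)) = inj₂ (inj₁ p)

  reverse-path : ∀ {x y} → x ⇝ y → y ⇝ x
  reverse-path = reverse UnionEdge-sym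

  Pair⇒edge : ∀ {i j} → Pair n m i j → UnionEdge n m j i
  Pair⇒edge p = inj₁ (inj₂ p)

  Pair⇒φ-edge : ∀ {i j} → Pair n m i j → 1 < i → UnionEdge n m (i ∸ 1) (j ∸ 1)
  Pair⇒φ-edge {i} {j} p 1<i = inj₂ (inj₁ (inj₂ (i , j , p , 1<i , refl , refl)))

  module _ (T : IsPlaneTree n m) where
    open IsPlaneTree T
    open IsPerfectMatching matching

    pair-from-partner : ∀ {x} → 1 ≤ x → x ≤ 2 * n → m x < x → Pair n m (m x) x
    pair-from-partner {x} 1≤x x≤2n mx<x =
      proj₁ (inRange x 1≤x x≤2n) , mx<x , x≤2n , invol x 1≤x x≤2n

    pair-to-partner : ∀ {x} → 1 ≤ x → x ≤ 2 * n → x < m x → Pair n m x (m x)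
    pair-to-partner {x} 1≤x x≤2n x<mx = 1≤x , x<mx , proj₂ (inRange x 1≤x x≤2n) , refl

    partner-pair : ∀ {x} → 1 ≤ x → x ≤ 2 * n → Pair n m (m x) x ⊎ Pair n m x (m x)
    partner-pair {x} 1≤x x≤2n with <-cmp (m x) x
    ... | tri< mx<x _ _ = inj₁ (pair-from-partner 1≤x x≤2n mx<x)
    ... | tri≈ _ mx≡x _ = ⊥-elim (noFix x 1≤x x≤2n mx≡x)
    ... | tri> _ _ x<mx = inj₂ (pair-to-partner 1≤x x≤2n x<mx)

    Pair⇒Closed : ∀ {i j} → Pair n m i j → Closed m i j
    Pair⇒Closed {i} {j} p@(1≤i , i<j , j≤2n , mi≡j) x i<x x<j = i≤mx , mx<j
      where
      1≤x = ≤-trans 1≤i (<⇒≤ i<x)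
      x≤2n = ≤-trans (<⇒≤ x<j) j≤2n

      i≤mx : i ≤ m x
      i≤mx with <-cmp (m x) i
      ... | tri< mx<i _ _ = ⊥-elim (noncrossing (m x) i x j mx<i i<x x<j
              (pair-from-partner 1≤x x≤2n (<-trans mx<i i<x)) p)
      ... | tri≈ _ mx≡i _ = ≤-reflexive (sym mx≡i)
      ... | tri> _ _ i<mx = <⇒≤ i<mx

      mx<j : m x < j
      mx<j with <-cmp (m x) j
      ... | tri< mx<j _ _ = mx<j
      ... | tri≈ _ mx≡j _ = ⊥-elim (<⇒≢ i<x (sym x≡i))
        where
        open ≡-Reasoning
        x≡i : x ≡ i
        x≡i = begin
          x        ≡⟨ sym (invol x 1≤x x≤2n) ⟩
          m (m x)  ≡⟨ cong m mx≡j ⟩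
          m j      ≡⟨ cong m (sym mi≡j) ⟩
          m (m i)  ≡⟨ invol i 1≤i (≤-trans (<⇒≤ i<j) j≤2n) ⟩
          i        ∎
      ... | tri> _ _ j<mx = ⊥-elim (noncrossing i x j (m x) i<x x<j j<mx p
              (pair-to-partner 1≤x x≤2n (<-trans x<j j<mx)))

    whole-Closed : Closed m 1 (suc (2 * n))
    whole-Closed x 1<x (s≤s x≤2n) with inRange x (<⇒≤ 1<x) x≤2n
    ... | 1≤mx , mx≤2n = 1≤mx , s≤s mx≤2n

    -- The case distinctions are arguments of the step so that both Acc
    -- arguments are matched in the clauses that make the recursive calls.
    Closed⇒⇝left : ∀ {i j x} → Acc _<_ j → Acc _<_ x →
                   1 ≤ i → j ≤ suc (2 * n) → Closed m i j → i ≤ x → x < j → x ⇝ i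
    step-Closed⇒⇝left : ∀ {i j x} → Acc _<_ j → Acc _<_ x →
                        1 ≤ i → j ≤ suc (2 * n) → Closed m i j → x < j →
                        i < x ⊎ i ≡ x → Pair n m (m x) x ⊎ Pair n m x (m x) → x ⇝ i

    Closed⇒⇝left acc-j acc-x 1≤i j≤2n+1 closed i≤x x<j =
      step-Closed⇒⇝left acc-j acc-x 1≤i j≤2n+1 closed x<j (m≤n⇒m<n∨m≡n i≤x)
        (partner-pair (≤-trans 1≤i i≤x) (≤-pred (<-≤-trans x<j j≤2n+1)))

    step-Closed⇒⇝left _ _ _ _ _ _ (inj₂ refl) _ = ε
    step-Closed⇒⇝left {x = x} acc-j (acc below-x) 1≤i j≤2n+1 closed x<j
                      (inj₁ i<x) (inj₁ back@(_ , mx<x , _)) =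
      Pair⇒edge back
        ◅ Closed⇒⇝left acc-j (below-x mx<x) 1≤i j≤2n+1 closed
            (proj₁ (closed x i<x x<j)) (<-trans mx<x x<j)
    step-Closed⇒⇝left {x = x} acc-j@(acc below-j) (acc below-x) 1≤i j≤2n+1 closed x<j
                      (inj₁ i<x) (inj₂ fwd@(1≤x , x<mx , mx≤2n , _)) =
      let (x≤mx-1 , mx-1<mx) = ∸1-between x<mx
          (i≤x-1 , x-1<x) = ∸1-between i<x
      in reverse-path
           (Closed⇒⇝left (below-j (proj₂ (closed x i<x x<j))) (<-wellFounded _) 1≤x
              (≤-trans mx≤2n (n≤1+n _)) (Pair⇒Closed fwd) x≤mx-1 mx-1<mx)
         ◅◅ UnionEdge-sym (Pair⇒φ-edge fwd (≤-trans (s≤s 1≤i) i<x))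
         ◅ Closed⇒⇝left acc-j (below-x x-1<x) 1≤i j≤2n+1 closed i≤x-1 (<-trans x-1<x x<j)

    index⇝1 : ∀ {x} → 1 ≤ x → x ≤ 2 * n → x ⇝ 1
    index⇝1 1≤x x≤2n =
      Closed⇒⇝left (<-wellFounded _) (<-wellFounded _) ≤-refl ≤-refl whole-Closed 1≤x (s≤s x≤2n)

lemma1 : (n : ℕ) → 1 ≤ n → (m : ℕ → ℕ) → IsPlaneTree n m → Complements n m
lemma1 n _ m T x y 1≤x x≤2n 1≤y y≤2n =
  index⇝1 n m T 1≤x x≤2n ◅◅ reverse-path n m (index⇝1 n m T 1≤y y≤2n)
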